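{- Let $G=(V,E)$ be a graph, let $u,v\in V$, let $\mathcal{O}$ be an orientation of $G$ and let $\delta$ be its outdegree sequence. Then $v$ is reachable from $u$ in $\mathcal{O}$ if and only if there is no subset $U\subseteq V$ with $u\in U$, $v\notin U$ and $\mathrm{exc}_\delta(U)=0$.
   Context: Graphs are finite, connected, and may have loops and multiple edges. An orientation chooses a direction for each edge; the outdegree sequence $\delta:V\to\mathbb{N}$ gives the number of arcs leaving each vertex (a loop contributes one to the outdegree of its vertex). $v$ is reachable from $u$ if there is a directed path from $u$ to $v$. For $\delta:V\to\mathbb{N}$ and $U\subseteq V$, the excess is $\mathrm{exc}_\delta(U)=\sum_{w\in U}\delta(w)-|G_U|$, where $|G_U|$ is the number of edges of $G$ having both endpoints in $U$. -}

module Defs where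

open import Data.Nat using (ℕ; suc)
open import Data.Fin using (Fin)
open import Data.Fin.Properties using (_≟_)
open import Data.Fin.Subset using (Subset; _∈_; _∉_)
open import Data.Fin.Subset.Properties using (_∈?_)
open import Data.Bool using (Bool; true; false; if_then_else_)
open import Data.Product using (Σ; _×_; _,_; proj₁; proj₂)
open import Data.List using (List; allFin; map)
open import Data.Nat.ListAction using (sum)
open import Data.Sum using (_⊎_)
open import Relation.Binary.PropositionalEquality using (_≡_)
open import Data.Integer using (ℤ; +_; _-_)
open import Relation.Nullary using (Dec; yes; no; _×-dec_)

-- A finite multigraph (loops and multiple edges allowed):
-- vertices Fin n, edges Fin m, each edge has an (unordered) pair of endpoints.
record Graph : Set where
  field
    n    : ℕ
    m    : ℕ
    ends : Fin m → Fin n × Fin n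

open Graph public

Vertex : Graph → Set
Vertex G = Fin (n G)

Edge : Graph → Set
Edge G = Fin (m G)

-- An orientation chooses a direction for each edge:
-- true  : the edge (a , b) is oriented a → b
-- false : the edge (a , b) is oriented b → a
Orientation : Graph → Set
Orientation G = Edge G → Bool

tail : (G : Graph) → Orientation G → Edge G → Vertex G
tail G O e = if O e then proj₁ (ends G e) else proj₂ (ends G e)

head : (G : Graph) → Orientation G → Edge G → Vertex G
head G O e = if O e then proj₂ (ends G e) else proj₁ (ends G e)

countFin : (k : ℕ) {P : Fin k → Set} → ((i : Fin k) → Dec (P i)) → ℕ
countFin k P? = sum (map (λ i → indicator (P? i)) (allFin k))
  where
  indicator : ∀ {A : Set} → Dec A → ℕ
  indicator (yes _) = 1
  indicator (no _)  = 0

Adjacent : (G : Graph) → Vertex G → Vertex G → Set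
Adjacent G x y = Σ (Edge G) λ e →
  (proj₁ (ends G e) ≡ x × proj₂ (ends G e) ≡ y) ⊎ (proj₁ (ends G e) ≡ y × proj₂ (ends G e) ≡ x)

data Walk (G : Graph) : Vertex G → Vertex G → Set where
  here  : ∀ {x} → Walk G x x
  there : ∀ {x y z} → Adjacent G x y → Walk G y z → Walk G x z

Connected : Graph → Set
Connected G = ∀ (x y : Vertex G) → Walk G x y

data Reachable (G : Graph) (O : Orientation G) : Vertex G → Vertex G → Set where
  refl-reach : ∀ {x} → Reachable G O x x
  step       : ∀ {y} (e : Edge G) → Reachable G O (head G O e) y
             → Reachable G O (tail G O e) y

-- outdegree sequence δ of the orientation (a loop contributes 1 to its vertex)
outdeg : (G : Graph) → Orientation G → Vertex G → ℕ
outdeg G O w = countFin (m G) (λ e → tail G O e ≟ w)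

edgesIn : (G : Graph) → Subset (n G) → ℕ
edgesIn G U = countFin (m G) (λ e → (proj₁ (ends G e) ∈? U) ×-dec (proj₂ (ends G e) ∈? U))

sumOver : (k : ℕ) → Subset k → (Fin k → ℕ) → ℕ
sumOver k U f = sum (map (λ w → g w (w ∈? U)) (allFin k))
  where
  g : (w : Fin k) → Dec (w ∈ U) → ℕ
  g w (yes _) = f w
  g w (no _)  = 0

exc : (G : Graph) → (Vertex G → ℕ) → Subset (n G) → ℤ
exc G δ U = + sumOver (n G) U δ - + edgesIn G U

{-# OPTIONS --safe #-}
-- Counting every arc at its tail, Σ_{w∈U} δ(w) is the number of edges with tail in U,
-- so exc_δ(U) is the number of arcs leaving U.  A directed path from u ∈ U to v ∉ U
-- uses such an arc, hence exc_δ(U) > 0.  Conversely the set of vertices reachable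
-- from u is left by no arc, so if it misses v it is a set of excess 0.
module Submission where

open import Defs
open import Data.Fin.Subset using (Subset; _∈_; _∉_)
open import Data.Integer using (ℤ; +_)
open import Data.Product using (Σ; _×_)
open import Relation.Nullary using (¬_)
open import Relation.Binary.PropositionalEquality using (_≡_)
open import Function.Bundles using (_⇔_)

open import Data.Bool using (if_then_else_; true; false)
open import Data.Bool.Properties using (∧-comm)
open import Data.Fin using (Fin; zero; suc)
open import Data.Fin.Properties using (_≟_; any?)
open import Data.Fin.Subset using (_∪_; ⁅_⁆; _⊂_; _⊃_)
open import Data.Fin.Subset.Induction using (Acc; acc; ⊃-wellFounded)
open import Data.Fin.Subset.Properties using (_∈?_; p⊆p∪q; x∈p∪q⁻; x∈p∪q⁺; x∈⁅x⁆; x∈⁅y⁆⇒x≡y)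
open import Data.Integer using (_⊖_)
open import Data.Integer.Properties using (+-injective; [+m]-[+n]≡m⊖n; ⊖-≥)
open import Data.List using (map; allFin; tabulate)
open import Data.List.Properties using (map-tabulate)
open import Data.Nat as ℕ using (ℕ; _+_; _*_; _≤_)
open import Data.Nat.ListAction using (sum)
open import Data.Nat.Properties using (+-*-semiring; +-identityʳ; *-identityʳ; *-zeroʳ; m≤m+n; m+n∸m≡n)
open import Algebra.Properties.Semiring.Sum +-*-semiring
  using (sum-syntax; sum-cong-≗; sum-replicate-zero; sum-remove; ∑-comm; ∑-distrib-+; *-distribʳ-sum)
open import Data.Product using (∃; Σ-syntax; _,_; proj₁; proj₂)
open import Data.Sum using (_⊎_; inj₁; inj₂)
open import Function using (_∘_; id)
open import Function.Bundles using (mk⇔; Equivalence)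
open import Relation.Binary.PropositionalEquality
  using (refl; sym; trans; cong; cong₂; subst; subst₂; module ≡-Reasoning)
open import Relation.Nullary using (Dec; yes; no; does; ¬?; _×-dec_; contradiction)
open import Relation.Nullary.Decidable using (dec-true; dec-false)
open import Relation.Unary using (Decidable)

𝟙 : ∀ {a} {A : Set a} → Dec A → ℕ
𝟙 a? = if does a? then 1 else 0

𝟙-yes : ∀ {a} {A : Set a} (a? : Dec A) → A → 𝟙 a? ≡ 1
𝟙-yes a? a = cong (λ b → if b then 1 else 0) (dec-true a? a)

𝟙-no : ∀ {a} {A : Set a} (a? : Dec A) → ¬ A → 𝟙 a? ≡ 0
𝟙-no a? ¬a = cong (λ b → if b then 1 else 0) (dec-false a? ¬a)

𝟙-×-comm : ∀ {a b} {A : Set a} {B : Set b} (a? : Dec A) (b? : Dec B) → 𝟙 (a? ×-dec b?) ≡ 𝟙 (b? ×-dec a?)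
𝟙-×-comm a? b? = cong (λ b → if b then 1 else 0) (∧-comm (does a?) (does b?))

𝟙-split : ∀ {a b} {A : Set a} {B : Set b} (a? : Dec A) (b? : Dec B) →
          𝟙 a? ≡ 𝟙 (a? ×-dec b?) + 𝟙 (a? ×-dec ¬? b?)
𝟙-split (yes _) (yes _) = refl
𝟙-split (yes _) (no _)  = refl
𝟙-split (no _)  _       = refl

sum-tabulate : ∀ {k} (f : Fin k → ℕ) → sum (tabulate f) ≡ ∑[ i < k ] f i
sum-tabulate {ℕ.zero}  f = refl
sum-tabulate {ℕ.suc k} f = cong (_+_ (f zero)) (sum-tabulate (f ∘ suc))

sum-map-allFin : ∀ {k} (f : Fin k → ℕ) → sum (map f (allFin k)) ≡ ∑[ i < k ] f i
sum-map-allFin f = trans (cong sum (map-tabulate id f)) (sum-tabulate f)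

-- The summands of countFin and sumOver are where-bound in Defs and cannot be named
-- here: the _ in these two signatures is solved by their use in countFin≡∑ and sumOver≡∑.
countFin-summand : ∀ {k} {P : Fin k → Set} (P? : Decidable P) (i : Fin k) → _ ≡ 𝟙 (P? i)
sumOver-summand : ∀ {k} (U : Subset k) (f : Fin k → ℕ) (w : Fin k) → _ ≡ f w * 𝟙 (w ∈? U)

countFin≡∑ : ∀ {k} {P : Fin k → Set} (P? : Decidable P) → countFin k P? ≡ ∑[ i < k ] 𝟙 (P? i)
countFin≡∑ {k} P? = trans (sum-map-allFin {k} _) (sum-cong-≗ (countFin-summand P?))

sumOver≡∑ : ∀ {k} (U : Subset k) (f : Fin k → ℕ) → sumOver k U f ≡ ∑[ w < k ] (f w * 𝟙 (w ∈? U))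
sumOver≡∑ {k} U f = trans (sum-map-allFin {k} _) (sum-cong-≗ (sumOver-summand U f))

countFin-summand P? i with P? i
... | yes _ = refl
... | no _  = refl

sumOver-summand U f w with w ∈? U
... | yes _ = sym (*-identityʳ (f w))
... | no _  = sym (*-zeroʳ (f w))

∑-select : ∀ {k} (x : Fin k) (f : Fin k → ℕ) → ∑[ w < k ] (𝟙 (x ≟ w) * f w) ≡ f x
∑-select {ℕ.suc k} zero    f =
  trans (cong₂ _+_ (+-identityʳ (f zero)) (sum-replicate-zero k)) (+-identityʳ (f zero))
∑-select {ℕ.suc k} (suc x) f = ∑-select x (f ∘ suc)

term≤∑ : ∀ {k} (f : Fin k → ℕ) (i : Fin k) → f i ≤ ∑[ j < k ] f j
term≤∑ {ℕ.suc k} f i = subst (f i ≤_) (sym (sum-remove {i = i} f)) (m≤m+n (f i) _)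

∑𝟙≡0⇒∀¬ : ∀ {k} {P : Fin k → Set} (P? : Decidable P) → ∑[ i < k ] 𝟙 (P? i) ≡ 0 → ∀ i → ¬ P i
∑𝟙≡0⇒∀¬ P? ∑≡0 i p with () ← subst₂ _≤_ (𝟙-yes (P? i) p) ∑≡0 (term≤∑ (𝟙 ∘ P?) i)

∀¬⇒∑𝟙≡0 : ∀ {k} {P : Fin k → Set} (P? : Decidable P) → (∀ i → ¬ P i) → ∑[ i < k ] 𝟙 (P? i) ≡ 0
∀¬⇒∑𝟙≡0 {k} P? ∀¬ = trans (sum-cong-≗ (λ i → 𝟙-no (P? i) (∀¬ i))) (sum-replicate-zero k)

sumOver-fibres : ∀ {k m} (U : Subset k) (f : Fin m → Fin k) →
                 sumOver k U (λ w → countFin m (λ e → f e ≟ w)) ≡ countFin m (λ e → f e ∈? U)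
sumOver-fibres {k} {m} U f = begin
  sumOver k U (λ w → countFin m (λ e → f e ≟ w))
    ≡⟨ sumOver≡∑ U _ ⟩
  ∑[ w < k ] (countFin m (λ e → f e ≟ w) * 𝟙 (w ∈? U))
    ≡⟨ sum-cong-≗ (λ w → cong (_* 𝟙 (w ∈? U)) (countFin≡∑ (λ e → f e ≟ w))) ⟩
  ∑[ w < k ] ((∑[ e < m ] 𝟙 (f e ≟ w)) * 𝟙 (w ∈? U))
    ≡⟨ sum-cong-≗ (λ w → *-distribʳ-sum {m} (𝟙 (w ∈? U)) _) ⟩
  ∑[ w < k ] ∑[ e < m ] (𝟙 (f e ≟ w) * 𝟙 (w ∈? U))
    ≡⟨ ∑-comm {k} {m} _ ⟩
  ∑[ e < m ] ∑[ w < k ] (𝟙 (f e ≟ w) * 𝟙 (w ∈? U))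
    ≡⟨ sum-cong-≗ (λ e → ∑-select (f e) (𝟙 ∘ (_∈? U))) ⟩
  ∑[ e < m ] 𝟙 (f e ∈? U)
    ≡⟨ countFin≡∑ (λ e → f e ∈? U) ⟨
  countFin m (λ e → f e ∈? U)
    ∎
  where open ≡-Reasoning

x∉p⇒p⊂p∪⁅x⁆ : ∀ {k} {x : Fin k} {p : Subset k} → x ∉ p → p ⊂ p ∪ ⁅ x ⁆
x∉p⇒p⊂p∪⁅x⁆ {x = x} {p} x∉p = p⊆p∪q ⁅ x ⁆ , x , x∈p∪q⁺ (inj₂ (x∈⁅x⁆ x)) , x∉p

m+n⊖m≡n : ∀ m n → (m + n) ⊖ m ≡ + n
m+n⊖m≡n m n = trans (⊖-≥ (m≤m+n m n)) (cong +_ (m+n∸m≡n m n))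

module _ {G : Graph} (O : Orientation G) where

  Leaves : Subset (n G) → Edge G → Set
  Leaves U e = tail G O e ∈ U × head G O e ∉ U

  leaves? : (U : Subset (n G)) → Decidable (Leaves U)
  leaves? U e = tail G O e ∈? U ×-dec ¬? (head G O e ∈? U)

  OutClosed : Subset (n G) → Set
  OutClosed U = ∀ e → ¬ Leaves U e

  𝟙-tail∈-split : (U : Subset (n G)) (e : Edge G) →
    𝟙 (tail G O e ∈? U) ≡ 𝟙 (proj₁ (ends G e) ∈? U ×-dec proj₂ (ends G e) ∈? U) + 𝟙 (leaves? U e)
  𝟙-tail∈-split U e = trans (𝟙-split (tail G O e ∈? U) (head G O e ∈? U)) (cong (_+ 𝟙 (leaves? U e)) ends∈)
    where
    ends∈ : 𝟙 (tail G O e ∈? U ×-dec head G O e ∈? U) ≡ 𝟙 (proj₁ (ends G e) ∈? U ×-dec proj₂ (ends G e) ∈? U)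
    ends∈ with O e
    ... | true  = refl
    ... | false = 𝟙-×-comm (proj₂ (ends G e) ∈? U) (proj₁ (ends G e) ∈? U)

  exc-outdeg : (U : Subset (n G)) → exc G (outdeg G O) U ≡ + ∑[ e < m G ] 𝟙 (leaves? U e)
  exc-outdeg U = begin
    exc G (outdeg G O) U
      ≡⟨ [+m]-[+n]≡m⊖n (sumOver (n G) U (outdeg G O)) (edgesIn G U) ⟩
    sumOver (n G) U (outdeg G O) ⊖ edgesIn G U
      ≡⟨ cong₂ _⊖_ (sumOver-fibres U (tail G O)) (countFin≡∑ internal?) ⟩
    countFin (m G) (λ e → tail G O e ∈? U) ⊖ #internal
      ≡⟨ cong (_⊖ #internal) (countFin≡∑ (λ e → tail G O e ∈? U)) ⟩
    ∑[ e < m G ] 𝟙 (tail G O e ∈? U) ⊖ #internal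
      ≡⟨ cong (_⊖ #internal) (trans (sum-cong-≗ (𝟙-tail∈-split U)) (∑-distrib-+ {m G} _ _)) ⟩
    (#internal + #leaving) ⊖ #internal
      ≡⟨ m+n⊖m≡n #internal #leaving ⟩
    + #leaving
      ∎
    where
    open ≡-Reasoning
    internal? : (e : Edge G) → Dec (proj₁ (ends G e) ∈ U × proj₂ (ends G e) ∈ U)
    internal? e = proj₁ (ends G e) ∈? U ×-dec proj₂ (ends G e) ∈? U
    #internal #leaving : ℕ
    #internal = ∑[ e < m G ] 𝟙 (internal? e)
    #leaving  = ∑[ e < m G ] 𝟙 (leaves? U e)

  exc≡0⇔OutClosed : (U : Subset (n G)) → exc G (outdeg G O) U ≡ + 0 ⇔ OutClosed U
  exc≡0⇔OutClosed U = mk⇔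
    (λ exc≡0 → ∑𝟙≡0⇒∀¬ (leaves? U) (+-injective (trans (sym (exc-outdeg U)) exc≡0)))
    (λ closed → trans (exc-outdeg U) (cong +_ (∀¬⇒∑𝟙≡0 (leaves? U) closed)))

  Reaches : Vertex G → Subset (n G) → Set
  Reaches u R = ∀ {w} → w ∈ R → Reachable G O u w

  leaving-edge : ∀ {U x y} → Reachable G O x y → x ∈ U → y ∉ U → ∃ (Leaves U)
  leaving-edge refl-reach x∈U y∉U = contradiction x∈U y∉U
  leaving-edge {U} (step e r) t∈U y∉U with head G O e ∈? U
  ... | yes h∈U = leaving-edge r h∈U y∉U
  ... | no  h∉U = e , t∈U , h∉U

  reach-snoc : ∀ {x} (e : Edge G) → Reachable G O x (tail G O e) → Reachable G O x (head G O e)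
  reach-snoc e refl-reach   = step e refl-reach
  reach-snoc e (step e′ r) = step e′ (reach-snoc e r)

  Reaches-⁅⁆ : ∀ u → Reaches u ⁅ u ⁆
  Reaches-⁅⁆ u w∈⁅u⁆ rewrite x∈⁅y⁆⇒x≡y u w∈⁅u⁆ = refl-reach

  Reaches-∪-head : ∀ {u R} (e : Edge G) → tail G O e ∈ R → Reaches u R → Reaches u (R ∪ ⁅ head G O e ⁆)
  Reaches-∪-head {R = R} e t∈R u↝R w∈ with x∈p∪q⁻ R _ w∈
  ... | inj₁ w∈R   = u↝R w∈R
  ... | inj₂ w∈⁅h⁆ rewrite x∈⁅y⁆⇒x≡y _ w∈⁅h⁆ = reach-snoc e (u↝R t∈R)

  saturate : ∀ {u} R → Acc _⊃_ R → u ∈ R → Reaches u R →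
             Σ[ S ∈ Subset (n G) ] (u ∈ S × Reaches u S × OutClosed S)
  saturate R (acc rs) u∈R u↝R with any? (leaves? R)
  ... | no ∄e = R , u∈R , u↝R , λ e e-leaves → ∄e (e , e-leaves)
  ... | yes (e , t∈R , h∉R) =
    saturate (R ∪ ⁅ head G O e ⁆) (rs (x∉p⇒p⊂p∪⁅x⁆ h∉R)) (p⊆p∪q _ u∈R) (Reaches-∪-head e t∈R u↝R)

  reachable⊎cut : ∀ u v → Reachable G O u v ⊎ Σ[ U ∈ Subset (n G) ] (u ∈ U × v ∉ U × OutClosed U)
  reachable⊎cut u v with saturate ⁅ u ⁆ (⊃-wellFounded _) (x∈⁅x⁆ u) (Reaches-⁅⁆ u)
  ... | R , u∈R , u↝R , closed with v ∈? R
  ...   | yes v∈R = inj₁ (u↝R v∈R)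
  ...   | no  v∉R = inj₂ (R , u∈R , v∉R , closed)

lemma1 : (G : Graph) → Connected G → (u v : Vertex G) → (O : Orientation G) →
    Reachable G O u v ⇔
      (¬ Σ (Subset (n G)) (λ U → u ∈ U × v ∉ U × exc G (outdeg G O) U ≡ + 0))
lemma1 G _ u v O = mk⇔ no-tight-cut reachable
  where
  no-tight-cut : Reachable G O u v → ¬ Σ (Subset (n G)) (λ U → u ∈ U × v ∉ U × exc G (outdeg G O) U ≡ + 0)
  no-tight-cut u↝v (U , u∈U , v∉U , exc≡0) =
    let e , e-leaves = leaving-edge O u↝v u∈U v∉U
    in Equivalence.to (exc≡0⇔OutClosed O U) exc≡0 e e-leaves
  reachable : ¬ Σ (Subset (n G)) (λ U → u ∈ U × v ∉ U × exc G (outdeg G O) U ≡ + 0) → Reachable G O u v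
  reachable ∄cut with reachable⊎cut O u v
  ... | inj₁ u↝v = u↝v
  ... | inj₂ (U , u∈U , v∉U , closed) =
    contradiction (U , u∈U , v∉U , Equivalence.from (exc≡0⇔OutClosed O U) closed) ∄cut
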